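{- Let $R$ be an SMLL net. The set of links of $R$, equipped with the relation $\prec$ (where $l_1 \prec l_2$ iff there is a polarized path from $l_1$ to $l_2$), is a finite strict partial order.
   Context: SMLL formulas are generated by $A ::= 1 \mid \bot \mid X \mid X^\bot \mid A\otimes A \mid A ⅋ A$ (⅋ is the multiplicative disjunction "par"), with involutive linear negation $1^\bot=\bot$, $(A\otimes B)^\bot = A^\bot ⅋ B^\bot$. Positive formulas are $P ::= 1 \mid P\otimes P$, negative formulas are $N ::= \bot \mid N ⅋ N$. An SMLL structure is a directed multigraph whose edges are typed by formulas and whose nodes (links) are: axiom (conclusions $A, A^\bot$), cut (premisses $A, A^\bot$), $\otimes$ and ⅋ (premisses $A,B$, conclusion $A\otimes B$, resp. $A ⅋ B$), one (conclusion $1$), bot (conclusion $\bot$), and $n$-ary sync links with $n$ premisses and $n$ conclusions, the $i$-th premiss and the $i$-th conclusion having the same type, which is positive or negative. The in-edges of a sync link are its positive premisses and negative conclusions, its out-edges are its positive conclusions and negative premisses. Each bot link comes with a box containing a substructure of conclusions $\Gamma$; the box has conclusions $\bot,\Gamma$ ($\bot$ being its lock); boxes are nested or disjoint. A switching path is an undirected simple path using at most one premiss of each ⅋ link and at most one out-edge of each sync link. The 0-graph of $R$ is obtained by replacing each box by a single node with the same conclusions and restricting to depth 0. $R$ is a net (correct) if its 0-graph has no cyclic switching path and the content of each box is correct. An edge is polarized if its type is positive or negative; a node is polarized if all its conclusions are. A polarized path is a path of polarized edges connecting polarized nodes, going upwards on negative edges and downwards on positive edges, and not entering boxes. -}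

module Defs where

open import Data.Nat using (ℕ)
open import Data.Fin using (Fin; zero; suc; inject₁)
open import Data.Fin.Subset using (Subset; _∈_; _∉_)
open import Data.Maybe using (Maybe; just; nothing)
open import Data.Product using (Σ; ∃; _×_; _,_)
open import Data.Sum using (_⊎_)
open import Data.Unit using (⊤)
open import Relation.Nullary using (¬_)
open import Relation.Binary.PropositionalEquality using (_≡_; _≢_)
open import Function.Definitions using (Injective)

infixr 6 _⊗_ _⅋_

data Formula : Set where
  𝟙 ⊥f     : Formula
  var nvar : ℕ → Formula           -- X and X^⊥
  _⊗_ _⅋_  : Formula → Formula → Formula

_^⊥ : Formula → Formula
𝟙 ^⊥ = ⊥f
⊥f ^⊥ = 𝟙
var x ^⊥ = nvar x
nvar x ^⊥ = var x
(A ⊗ B) ^⊥ = (A ^⊥) ⅋ (B ^⊥)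
(A ⅋ B) ^⊥ = (A ^⊥) ⊗ (B ^⊥)

data Positive : Formula → Set where
  pos-one    : Positive 𝟙
  pos-tensor : ∀ {A B} → Positive A → Positive B → Positive (A ⊗ B)

data Negative : Formula → Set where
  neg-bot : Negative ⊥f
  neg-par : ∀ {A B} → Negative A → Negative B → Negative (A ⅋ B)

Polarized : Formula → Set
Polarized A = Positive A ⊎ Negative A

data Kind : Set where
  ax cut tens par one bot : Kind
  sync : ℕ → Kind

inAr : Kind → ℕ
inAr ax = 0
inAr cut = 2
inAr tens = 2
inAr par = 2
inAr one = 0
inAr bot = 0
inAr (sync n) = n

outAr : Kind → ℕ
outAr ax = 2
outAr cut = 0
outAr tens = 1
outAr par = 1
outAr one = 1
outAr bot = 1
outAr (sync n) = n

WellTyped : (k : Kind) → (Fin (inAr k) → Formula) → (Fin (outAr k) → Formula) → Set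
WellTyped ax p c = c (suc zero) ≡ (c zero) ^⊥
WellTyped cut p c = p (suc zero) ≡ (p zero) ^⊥
WellTyped tens p c = c zero ≡ p zero ⊗ p (suc zero)
WellTyped par p c = c zero ≡ p zero ⅋ p (suc zero)
WellTyped one p c = c zero ≡ 𝟙
WellTyped bot p c = c zero ≡ ⊥f
WellTyped (sync n) p c = ∀ i → p i ≡ c i × Polarized (p i)

-- A premiss slot is (l , i) with
-- i < inAr (kind l); a conclusion slot is (l , i) with i < outAr (kind l).
-- content b is the set of links inside the box of the bot link b
-- (the lock b itself is not in its content).

record Structure : Set where
  field
    nL nE   : ℕ
    kind    : Fin nL → Kind
    type    : Fin nE → Formula
    prem    : Σ (Fin nL) (λ l → Fin (inAr (kind l))) → Fin nE
    concl   : Σ (Fin nL) (λ l → Fin (outAr (kind l))) → Fin nE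
    content : Fin nL → Subset nL

module _ (R : Structure) where
  open Structure R

  Conc : Fin nL → Fin nE → Set
  Conc l e = Σ (Fin (outAr (kind l))) λ i → concl (l , i) ≡ e

  Prem : Fin nL → Fin nE → Set
  Prem l e = Σ (Fin (inAr (kind l))) λ i → prem (l , i) ≡ e

  record IsStructure : Set where
    field
      concl-inj  : Injective _≡_ _≡_ concl
      concl-surj : ∀ e → ∃ λ l → Conc l e
      prem-inj   : Injective _≡_ _≡_ prem
      typed      : ∀ l → WellTyped (kind l) (λ i → type (prem (l , i)))
                                             (λ i → type (concl (l , i)))
      box-bot    : ∀ b l → l ∈ content b → kind b ≡ bot
      box-lock   : ∀ b → b ∉ content b
      box-closed : ∀ b l l' e → Conc l e → Prem l' e → l' ∈ content b → l ∈ content b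
      box-nest   : ∀ b b' → b ∈ content b' → ∀ l → l ∈ content b → l ∈ content b'
      box-disj   : ∀ b b' → b ≢ b' → b ∉ content b' → b' ∉ content b →
                   ∀ l → l ∈ content b → l ∉ content b'

  -- Regions: the whole structure (nothing) or the content of a box (just b).
  -- The 0-graph of a region replaces each outermost box of the region by a node.

  InReg : Maybe (Fin nL) → Fin nL → Set
  InReg nothing l = ⊤
  InReg (just b) l = l ∈ content b

  -- l is a node of the 0-graph of region r (a depth-0 link; bot links stand
  -- for their boxes)
  Top : Maybe (Fin nL) → Fin nL → Set
  Top r l = InReg r l × (∀ b → InReg r b → l ∉ content b)

  Rep : Maybe (Fin nL) → Fin nL → Fin nL → Set
  Rep r l v = InReg r l × Top r v × (v ≡ l ⊎ l ∈ content v)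

  ZeroEdge : Maybe (Fin nL) → Fin nE → Fin nL → Fin nL → Set
  ZeroEdge r e v w = Σ (Fin nL) λ l → Σ (Fin nL) λ l' →
    Conc l e × Prem l' e × Rep r l v × Rep r l' w ×
    ¬ (Σ (Fin nL) λ b → InReg r b × l ∈ content b × l' ∈ content b)

  SyncOut : Fin nL → Fin nE → Set
  SyncOut s e = (Conc s e × Positive (type e)) ⊎ (Prem s e × Negative (type e))

  record SwitchingCycle (r : Maybe (Fin nL)) : Set where
    field
      k       : ℕ
      node    : Fin (ℕ.suc (ℕ.suc k)) → Fin nL
      edge    : Fin (ℕ.suc k) → Fin nE
      closed  : node (Data.Fin.fromℕ (ℕ.suc k)) ≡ node zero
      joins   : ∀ i → ZeroEdge r (edge i) (node (inject₁ i)) (node (suc i))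
                    ⊎ ZeroEdge r (edge i) (node (suc i)) (node (inject₁ i))
      node-inj : ∀ i j → node (inject₁ i) ≡ node (inject₁ j) → i ≡ j
      edge-inj : Injective _≡_ _≡_ edge
      par-sw  : ∀ i j → i ≢ j → ∀ p → kind p ≡ par →
                  ¬ (Prem p (edge i) × Prem p (edge j))
      sync-sw : ∀ i j → i ≢ j → ∀ s n → kind s ≡ sync n →
                  ¬ (SyncOut s (edge i) × SyncOut s (edge j))

  -- R is a net: its 0-graph has no cyclic switching path and (recursively)
  -- the content of each box is correct, i.e. the 0-graph of every box content
  -- has no cyclic switching path.
  record IsNet : Set where
    field
      isStructure : IsStructure
      acyclic     : ∀ r → ¬ SwitchingCycle r

  PolNode : Fin nL → Set
  PolNode l = ∀ i → Polarized (type (concl (l , i)))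

  -- one step of a polarized path from l to l' through edge e:
  -- downwards along a positive edge, or upwards along a negative edge,
  -- between polarized nodes, without entering a box
  data PStep (l l' : Fin nL) : Set where
    step : (e : Fin nE) → PolNode l → PolNode l' →
           ((Positive (type e) × Conc l e × Prem l' e) ⊎
            (Negative (type e) × Prem l e × Conc l' e)) →
           (∀ b → l' ∈ content b → l ∈ content b) →
           PStep l l'

  data PPath : Fin nL → Fin nL → Set where
    [_]  : ∀ {l l'} → PStep l l' → PPath l l'
    _∷_  : ∀ {l l' l''} → PStep l l' → PPath l' l'' → PPath l l''

  _≺_ : Fin nL → Fin nL → Set
  l₁ ≺ l₂ = PPath l₁ l₂

-- A polarized path never enters a box, so along a cyclic polarized path every link lies in
-- the same boxes, and the cycle lives in the 0-graph of the innermost region containing its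
-- links. Each step leaves its source link through an edge that this link emits in the
-- polarized sense (a positive conclusion or a negative premiss), and every edge is emitted
-- by at most one link. A polarized ⅋ link has negative premisses, so a ⅋ premiss crossed by
-- the path is emitted by the ⅋ link itself. Once repeated links are cut out, the distinct
-- links of the cycle therefore give distinct edges, at most one premiss of each ⅋ link and
-- at most one out-edge of each sync link: a switching cycle, which a net does not have.
-- Transitivity is concatenation of paths, and finiteness comes from links forming Fin nL.
module Submission where

open import Defs
open import Level using (_⊔_)
open import Data.Fin using (Fin; zero; suc; inject₁; fromℕ)
open import Data.Fin.Properties using (any?; fromℕ≢inject₁; inject₁-injective; _≟_)
open import Data.Fin.Subset using (_∈_; _⊂_; ∣_∣)
open import Data.Fin.Subset.Properties using (_∈?_; p⊂q⇒∣p∣<∣q∣)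
open import Data.Nat using (ℕ; suc; _<_)
open import Data.Nat.Induction using (<-wellFounded)
open import Induction.WellFounded using (Acc; acc)
open import Data.Maybe using (Maybe; just; nothing)
open import Data.Product using (Σ; ∃; _×_; _,_; proj₁; proj₂; swap)
open import Data.Sum using (_⊎_; inj₁; inj₂)
open import Data.Unit.Polymorphic using (⊤)
open import Data.Empty using (⊥-elim)
open import Function using (id; _∘_)
open import Relation.Nullary using (¬_; yes; no)
open import Relation.Nullary.Decidable using (_×-dec_)
open import Relation.Binary.Core using (Rel)
open import Relation.Binary.Definitions using (DecidableEquality; Transitive)
open import Relation.Binary.PropositionalEquality
  using (_≡_; _≢_; refl; sym; trans; cong; subst; resp₂; isEquivalence)
open import Relation.Binary.Structures using (IsStrictPartialOrder)
open import Relation.Binary.Construct.Closure.ReflexiveTransitive using (Star; ε; _◅_)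

positive⇒¬negative : ∀ {A} → Positive A → ¬ Negative A
positive⇒¬negative pos-one ()
positive⇒¬negative (pos-tensor _ _) ()

polarized-⅋⇒negative : ∀ {A B} → Polarized (A ⅋ B) → Negative A × Negative B
polarized-⅋⇒negative (inj₁ ())
polarized-⅋⇒negative (inj₂ (neg-par nA nB)) = nA , nB

-- Stated for any kind k ≡ par, since kind x cannot be rewritten to par inside the types of
-- prem and concl.
polarized-par⇒negative-premisses : ∀ {k P C} → k ≡ par → WellTyped k P C →
  (∀ o → Polarized (C o)) → ∀ i → Negative (P i)
polarized-par⇒negative-premisses refl typed polarized zero =
  proj₁ (polarized-⅋⇒negative (subst Polarized typed (polarized zero)))
polarized-par⇒negative-premisses refl typed polarized (suc zero) =
  proj₂ (polarized-⅋⇒negative (subst Polarized typed (polarized zero)))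

module Walks {a ℓ} {A : Set a} (_⟶_ : Rel A ℓ) where

  Walk : Rel A (a ⊔ ℓ)
  Walk = Star _⟶_

  length : ∀ {x y} → Walk x y → ℕ
  length ε = 0
  length (_ ◅ w) = suc (length w)

  node : ∀ {x y} (w : Walk x y) → Fin (suc (length w)) → A
  node {x} ε zero = x
  node {x} (_ ◅ w) zero = x
  node (_ ◅ w) (suc i) = node w i

  node-zero : ∀ {x y} (w : Walk x y) → node w zero ≡ x
  node-zero ε = refl
  node-zero (_ ◅ _) = refl

  node-last : ∀ {x y} (w : Walk x y) → node w (fromℕ (length w)) ≡ y
  node-last ε = refl
  node-last (_ ◅ w) = node-last w

  arc : ∀ {x y} (w : Walk x y) (i : Fin (length w)) → node w (inject₁ i) ⟶ node w (suc i)
  arc (s ◅ w) zero = subst (_ ⟶_) (sym (node-zero w)) s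
  arc (_ ◅ w) (suc i) = arc w i

  prefix : ∀ {x y} (w : Walk x y) (i : Fin (suc (length w))) → Walk x (node w i)
  prefix ε zero = ε
  prefix (_ ◅ _) zero = ε
  prefix (s ◅ w) (suc i) = s ◅ prefix w i

  suffix : ∀ {x y} (w : Walk x y) (i : Fin (suc (length w))) → Walk (node w i) y
  suffix ε zero = ε
  suffix (s ◅ w) zero = s ◅ w
  suffix (_ ◅ w) (suc i) = suffix w i

  Simple : ∀ {x y} → Walk x y → Set a
  Simple ε = ⊤
  Simple {x} (_ ◅ w) = (∀ i → node w i ≢ x) × Simple w

  simple⇒node-injective : ∀ {x y} (w : Walk x y) → Simple w →
    ∀ i j → node w i ≡ node w j → i ≡ j
  simple⇒node-injective ε _ zero zero _ = refl
  simple⇒node-injective (_ ◅ _) _ zero zero _ = refl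
  simple⇒node-injective (_ ◅ _) (fresh , _) zero (suc j) eq = ⊥-elim (fresh j (sym eq))
  simple⇒node-injective (_ ◅ _) (fresh , _) (suc i) zero eq = ⊥-elim (fresh i eq)
  simple⇒node-injective (_ ◅ w) (_ , simple) (suc i) (suc j) eq =
    cong suc (simple⇒node-injective w simple i j eq)

  suffix-simple : ∀ {x y} (w : Walk x y) → Simple w → ∀ i → Simple (suffix w i)
  suffix-simple ε _ zero = _
  suffix-simple (_ ◅ _) simple zero = simple
  suffix-simple (_ ◅ w) (_ , simple) (suc i) = suffix-simple w simple i

  simplify : DecidableEquality A → ∀ {x y} → Walk x y → Σ (Walk x y) Simple
  simplify _≟A_ ε = ε , _
  simplify _≟A_ {x} {y} (s ◅ w) with simplify _≟A_ w
  ... | w′ , simple with any? (λ i → node w′ i ≟A x)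
  ...   | yes (i , eq) =
            subst (λ z → Σ (Walk z y) Simple) eq (suffix w′ i , suffix-simple w′ simple i)
  ...   | no fresh = s ◅ w′ , (λ i eq → fresh (i , eq)) , simple

  cycle-node-injective : ∀ {x y} (s : x ⟶ y) (w : Walk y x) → Simple w →
    ∀ i j → node (s ◅ w) (inject₁ i) ≡ node (s ◅ w) (inject₁ j) → i ≡ j
  cycle-node-injective s w simple = injective
    where
    last≢inject₁ : ∀ i → node w (fromℕ (length w)) ≢ node w (inject₁ i)
    last≢inject₁ i eq = fromℕ≢inject₁ (simple⇒node-injective w simple _ _ eq)
    injective : ∀ i j → node (s ◅ w) (inject₁ i) ≡ node (s ◅ w) (inject₁ j) → i ≡ j
    injective zero zero _ = refl
    injective zero (suc j) eq = ⊥-elim (last≢inject₁ j (trans (node-last w) eq))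
    injective (suc i) zero eq = ⊥-elim (last≢inject₁ i (trans (node-last w) (sym eq)))
    injective (suc i) (suc j) eq =
      cong suc (inject₁-injective (simple⇒node-injective w simple _ _ eq))

  module _ {p} {P : A → Set p} (backward : ∀ {x y} → x ⟶ y → P y → P x) where

    walk-backward : ∀ {x y} → Walk x y → P y → P x
    walk-backward ε = id
    walk-backward (s ◅ w) = backward s ∘ walk-backward w

module _ (R : Structure) (isStructure : IsStructure R) where
  open Structure R
  open IsStructure isStructure

  conc-unique : ∀ {x y e} → Conc R x e → Conc R y e → x ≡ y
  conc-unique (_ , p) (_ , q) = cong proj₁ (concl-inj (trans p (sym q)))

  prem-unique : ∀ {x y e} → Prem R x e → Prem R y e → x ≡ y
  prem-unique (_ , p) (_ , q) = cong proj₁ (prem-inj (trans p (sym q)))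

  Emits : Fin nL → Fin nE → Set
  Emits l e = (Positive (type e) × Conc R l e) ⊎ (Negative (type e) × Prem R l e)

  emits-unique : ∀ {x y e} → Emits x e → Emits y e → x ≡ y
  emits-unique (inj₁ (_ , cx)) (inj₁ (_ , cy)) = conc-unique cx cy
  emits-unique (inj₁ (pos , _)) (inj₂ (neg , _)) = ⊥-elim (positive⇒¬negative pos neg)
  emits-unique (inj₂ (neg , _)) (inj₁ (pos , _)) = ⊥-elim (positive⇒¬negative pos neg)
  emits-unique (inj₂ (_ , px)) (inj₂ (_ , py)) = prem-unique px py

  syncOut⇒emits : ∀ {s e} → SyncOut R s e → Emits s e
  syncOut⇒emits (inj₁ out) = inj₁ (swap out)
  syncOut⇒emits (inj₂ out) = inj₂ (swap out)

  stepEdge : ∀ {l m} → PStep R l m → Fin nE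
  stepEdge (step e _ _ _ _) = e

  step-direction : ∀ {l m} (s : PStep R l m) →
    (Positive (type (stepEdge s)) × Conc R l (stepEdge s) × Prem R m (stepEdge s)) ⊎
    (Negative (type (stepEdge s)) × Prem R l (stepEdge s) × Conc R m (stepEdge s))
  step-direction (step _ _ _ direction _) = direction

  step-emits : ∀ {l m} (s : PStep R l m) → Emits l (stepEdge s)
  step-emits (step _ _ _ (inj₁ (pos , c , _)) _) = inj₁ (pos , c)
  step-emits (step _ _ _ (inj₂ (neg , p , _)) _) = inj₂ (neg , p)

  step-target-polarized : ∀ {l m} → PStep R l m → PolNode R m
  step-target-polarized (step _ _ polarized _ _) = polarized

  step-leaves-boxes : ∀ b {l m} → PStep R l m → m ∈ content b → l ∈ content b
  step-leaves-boxes b (step _ _ _ _ leaves) = leaves b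

  polarized-par-premiss-negative : ∀ {x e} → kind x ≡ par → PolNode R x → Prem R x e →
    Negative (type e)
  polarized-par-premiss-negative {x} kx polarized (i , refl) =
    polarized-par⇒negative-premisses kx (typed x) polarized i

  par-premiss⇒emits : ∀ {x l m} → kind x ≡ par → (s : PStep R l m) →
    Prem R x (stepEdge s) → Emits x (stepEdge s)
  par-premiss⇒emits kx s px with step-direction s
  ... | inj₂ (neg , _) = inj₂ (neg , px)
  ... | inj₁ (pos , _ , pm) with prem-unique px pm
  ...   | refl = ⊥-elim (positive⇒¬negative pos
                   (polarized-par-premiss-negative kx (step-target-polarized s) px))

  innermost-box : ∀ l b → l ∈ content b → Acc _<_ ∣ content b ∣ → ∃ λ r → Top R r l
  innermost-box l b l∈b (acc smaller)
    with any? (λ b′ → (b′ ∈? content b) ×-dec (l ∈? content b′))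
  ... | no none = just b , l∈b , λ b′ b′∈b l∈b′ → none (b′ , b′∈b , l∈b′)
  ... | yes (b′ , b′∈b , l∈b′) =
    innermost-box l b′ l∈b′ (smaller (p⊂q⇒∣p∣<∣q∣ content-b′⊂content-b))
    where
    content-b′⊂content-b : content b′ ⊂ content b
    content-b′⊂content-b = (λ {x} → box-nest b′ b b′∈b x) , b′ , b′∈b , box-lock b′

  innermost-region : ∀ l → ∃ λ r → Top R r l
  innermost-region l with any? (λ b → l ∈? content b)
  ... | yes (b , l∈b) = innermost-box l b l∈b (<-wellFounded _)
  ... | no none = nothing , _ , λ b _ l∈b → none (b , l∈b)

  Top-resp-boxes : ∀ r {l x} → (∀ b → l ∈ content b → x ∈ content b) →
    (∀ b → x ∈ content b → l ∈ content b) → Top R r l → Top R r x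
  Top-resp-boxes nothing _ x⊆l (_ , top) = _ , λ b rb x∈b → top b rb (x⊆l b x∈b)
  Top-resp-boxes (just b) l⊆x x⊆l (l∈b , top) =
    l⊆x b l∈b , λ b′ rb′ x∈b′ → top b′ rb′ (x⊆l b′ x∈b′)

  top-zeroEdge : ∀ r {e v w} → Conc R v e → Prem R w e → Top R r v → Top R r w →
    ZeroEdge R r e v w
  top-zeroEdge r {v = v} {w} c p tv tw =
    v , w , c , p , (proj₁ tv , tv , inj₁ refl) , (proj₁ tw , tw , inj₁ refl) ,
    λ { (b , rb , v∈b , _) → proj₂ tv b rb v∈b }

  open Walks (PStep R)

  polarized-cycle⇒switchingCycle : ∀ {l m} (s : PStep R l m) (w : Walk m l) → Simple w →
    ∃ (SwitchingCycle R)
  polarized-cycle⇒switchingCycle {l} s w simple = r , record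
    { k = length w
    ; node = node cycle
    ; edge = edge
    ; closed = node-last w
    ; joins = joins
    ; node-inj = node-injective
    ; edge-inj = λ {i} {j} eq →
        shared-emitter i j (emitted i) (subst (Emits _) eq (emitted i))
    ; par-sw = λ i j i≢j x kx (pi , pj) →
        i≢j (shared-emitter i j (par-premiss⇒emits kx (arc cycle i) pi)
                                (par-premiss⇒emits kx (arc cycle j) pj))
    ; sync-sw = λ i j i≢j x n kx (si , sj) →
        i≢j (shared-emitter i j (syncOut⇒emits si) (syncOut⇒emits sj))
    }
    where
    cycle : Walk l l
    cycle = s ◅ w
    r : Maybe (Fin nL)
    r = proj₁ (innermost-region l)

    node-top : ∀ i → Top R r (node cycle i)
    node-top i = Top-resp-boxes r
      (λ b → walk-backward (step-leaves-boxes b) (suffix cycle i))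
      (λ b → walk-backward (step-leaves-boxes b) (prefix cycle i))
      (proj₂ (innermost-region l))

    edge : Fin (suc (length w)) → Fin nE
    edge i = stepEdge (arc cycle i)

    joins : ∀ i → ZeroEdge R r (edge i) (node cycle (inject₁ i)) (node cycle (suc i))
                ⊎ ZeroEdge R r (edge i) (node cycle (suc i)) (node cycle (inject₁ i))
    joins i with step-direction (arc cycle i)
    ... | inj₁ (_ , c , p) =
      inj₁ (top-zeroEdge r c p (node-top (inject₁ i)) (node-top (suc i)))
    ... | inj₂ (_ , p , c) =
      inj₂ (top-zeroEdge r c p (node-top (suc i)) (node-top (inject₁ i)))

    node-injective : ∀ i j → node cycle (inject₁ i) ≡ node cycle (inject₁ j) → i ≡ j
    node-injective = cycle-node-injective s w simple

    emitted : ∀ i → Emits (node cycle (inject₁ i)) (edge i)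
    emitted i = step-emits (arc cycle i)

    shared-emitter : ∀ {x} i j → Emits x (edge i) → Emits x (edge j) → i ≡ j
    shared-emitter i j xi xj =
      node-injective i j
        (trans (emits-unique (emitted i) xi) (sym (emits-unique (emitted j) xj)))

module _ (R : Structure) where
  open Walks (PStep R)

  ≺⇒walk : ∀ {l m} → _≺_ R l m → Walk l m
  ≺⇒walk [ s ] = s ◅ ε
  ≺⇒walk (s ∷ p) = s ◅ ≺⇒walk p

  no-closed-polarized-walk : IsNet R → ∀ {l m} → PStep R l m → ¬ Walk m l
  no-closed-polarized-walk net s w with simplify _≟_ w
  ... | w′ , simple with polarized-cycle⇒switchingCycle R (IsNet.isStructure net) s w′ simple
  ...   | r , cycle = IsNet.acyclic net r cycle

  ≺-irrefl : IsNet R → ∀ {l} → ¬ _≺_ R l l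
  ≺-irrefl net [ s ] = no-closed-polarized-walk net s ε
  ≺-irrefl net (s ∷ p) = no-closed-polarized-walk net s (≺⇒walk p)

  ≺-trans : Transitive (_≺_ R)
  ≺-trans [ s ] q = s ∷ q
  ≺-trans (s ∷ p) q = s ∷ ≺-trans p q

mainTheorem1 : (R : Structure) → IsNet R →
    IsStrictPartialOrder {A = Fin (Structure.nL R)} _≡_ (_≺_ R)
mainTheorem1 R net = record
  { isEquivalence = isEquivalence
  ; irrefl = λ { refl → ≺-irrefl R net }
  ; trans = ≺-trans R
  ; <-resp-≈ = resp₂ (_≺_ R)
  }
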